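{- Let $i$ and $s$ be states of an LTS with inputs and outputs such that $i$ is input enabled and $s$ is deterministic. If $i\mathrel{\mathsf{ioco}}s$ then $i\mathrel{\mathsf{iocos}}s$.
   Context: Actions: disjoint finite sets $I$ (inputs $a?$) and $O$ (outputs $a!$, including quiescence $\delta!$), $L=I\cup O$. An LTS with inputs and outputs is $(S,I,O,\to)$ with $\to\subseteq S\times L\times S$ such that $p\xrightarrow{\delta!}p'$ iff $p=p'$ and $p$ has no $a!$-transition for $a!\in O\setminus\{\delta!\}$; LTSs are image-finite. A state $i$ is input enabled if every state $i'$ reachable from $i$ has an $a?$-transition for every $a?\in I$. $s$ is deterministic if the LTS (of states reachable from $s$) is deterministic: whenever $p\xrightarrow{a}p'$ and $p\xrightarrow{a}p''$ then $p'=p''$. Transitions extend to sequences $\sigma\in L^*$ as usual; $\mathsf{traces}(p)=\{\sigma\mid\exists p'.\,p\xrightarrow{\sigma}p'\}$, $p\ \mathsf{after}\ \sigma=\{p'\mid p\xrightarrow{\sigma}p'\}$, $\mathsf{outs}(p)$ is the set of $a!\in O$ with $p\xrightarrow{a!}$, and $\mathsf{Out}(T)=\bigcup_{p\in T}\mathsf{outs}(p)$. $i\mathrel{\mathsf{ioco}}s$ iff $\mathsf{Out}(i\ \mathsf{after}\ \sigma)\subseteq\mathsf{Out}(s\ \mathsf{after}\ \sigma)$ for all $\sigma\in\mathsf{traces}(s)$. $\mathsf{ins}(p)$ is the set of inputs $a?$ with $p\xrightarrow{a?}$. An iocos-relation $R$ satisfies for every $(p,q)\in R$: (1) $\mathsf{ins}(q)\subseteq\mathsf{ins}(p)$;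 (2) for every $a?\in\mathsf{ins}(q)$ and $p\xrightarrow{a?}p'$ there is $q\xrightarrow{a?}q'$ with $(p',q')\in R$; (3) for every $a!\in O$ and $p\xrightarrow{a!}p'$ there is $q\xrightarrow{a!}q'$ with $(p',q')\in R$; $\mathsf{iocos}$ is the union of all iocos-relations. -}

module Defs where

open import Level using (Level; suc; _⊔_)
open import Data.Nat using (ℕ)
open import Data.Fin using (Fin)
open import Data.List using (List; []; _∷_)
open import Data.List.Membership.Propositional using (_∈_)
open import Data.Sum using (_⊎_; inj₁; inj₂)
open import Data.Product using (Σ; ∃; ∃-syntax; _×_; _,_)
open import Relation.Binary.PropositionalEquality using (_≡_)
open import Relation.Nullary using (¬_)
open import Function.Bundles using (_↔_; _⇔_)

IsFinite : Set → Set
IsFinite A = Σ ℕ λ n → A ↔ Fin n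

-- Inputs I and outputs O are disjoint finite sets; L = I ⊎ O (disjoint union),
-- so a? is (inp a) and a! is (out a).
record IOLTS : Set₁ where
  field
    S     : Set
    I     : Set
    O     : Set
    I-fin : IsFinite I
    O-fin : IsFinite O
    δ     : O

  L : Set
  L = I ⊎ O

  inp : I → L
  inp = inj₁

  out : O → L
  out = inj₂

  field
    _—[_]→_ : S → L → S → Set
    quiescence : ∀ p p' → (p —[ out δ ]→ p')
                   ⇔ (p ≡ p' × (∀ (a : O) → ¬ (a ≡ δ) → ∀ q → ¬ (p —[ out a ]→ q)))
    image-finite : ∀ p a → ∃[ qs ] (∀ q → (p —[ a ]→ q) ⇔ (q ∈ qs))

  infix 4 _—[_]→_ _=[_]⇒_

  data _=[_]⇒_ : S → List L → S → Set where
    refl* : ∀ {p} → p =[ [] ]⇒ p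
    step* : ∀ {p p' p'' a σ} → p —[ a ]→ p' → p' =[ σ ]⇒ p'' → p =[ a ∷ σ ]⇒ p''

  Reachable : S → S → Set
  Reachable p q = ∃[ σ ] (p =[ σ ]⇒ q)

  traces : S → List L → Set
  traces p σ = ∃[ p' ] (p =[ σ ]⇒ p')

  after : S → List L → S → Set
  after p σ p' = p =[ σ ]⇒ p'

  outs : S → O → Set
  outs p a = ∃[ p' ] (p —[ out a ]→ p')

  Out : (S → Set) → O → Set
  Out T a = ∃[ p ] (T p × outs p a)

  ins : S → I → Set
  ins p a = ∃[ p' ] (p —[ inp a ]→ p')

  InputEnabled : S → Set
  InputEnabled i = ∀ i' → Reachable i i' → ∀ (a : I) → ins i' a

  Deterministic : S → Set
  Deterministic s = ∀ p → Reachable s p → ∀ a p' p'' →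
                    p —[ a ]→ p' → p —[ a ]→ p'' → p' ≡ p''

  _ioco_ : S → S → Set
  i ioco s = ∀ σ → traces s σ → ∀ (a : O) → Out (after i σ) a → Out (after s σ) a

  record IsIocosRelation (R : S → S → Set) : Set where
    field
      ins-⊆  : ∀ {p q} → R p q → ∀ a → ins q a → ins p a
      inp-sim : ∀ {p q} → R p q → ∀ a → ins q a → ∀ {p'} → p —[ inp a ]→ p' →
                ∃[ q' ] (q —[ inp a ]→ q' × R p' q')
      out-sim : ∀ {p q} → R p q → ∀ (a : O) → ∀ {p'} → p —[ out a ]→ p' →
                ∃[ q' ] (q —[ out a ]→ q' × R p' q')

  _iocos_ : S → S → Set₁
  p iocos q = ∃[ R ] (IsIocosRelation R × R p q)

module Submission where

open import Defs
open import Data.List using ([]; _∷_; _++_; [_])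
open import Data.Product using (∃-syntax; _×_; _,_)
open import Relation.Binary.PropositionalEquality using (_≡_; refl)

-- The witnessing relation pairs the states reached from i and from s by a common
-- trace σ.  Input enabledness lets the i-side accept every input of the s-side,
-- and any move of the i-side along an input of the s-side is matched trivially.
-- For an output a! of the i-side, ioco yields some state of s after σ offering
-- a!; since s is deterministic, s after σ is a single state, so it is the
-- partner itself.

module _ (M : IOLTS) where
  open IOLTS M

  =[]⇒-snoc : ∀ {p q r σ a} → p =[ σ ]⇒ q → q —[ a ]→ r → p =[ σ ++ [ a ] ]⇒ r
  =[]⇒-snoc refl*        t′ = step* t′ refl*
  =[]⇒-snoc (step* t r) t′ = step* t (=[]⇒-snoc r t′)

  Deterministic-step : ∀ {s s′ a} → Deterministic s → s —[ a ]→ s′ → Deterministic s′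
  Deterministic-step {a = a} D t p (σ , r) = D p (a ∷ σ , step* t r)

  Deterministic-after : ∀ {s σ q₁ q₂} → Deterministic s →
                        s =[ σ ]⇒ q₁ → s =[ σ ]⇒ q₂ → q₁ ≡ q₂
  Deterministic-after D refl* refl* = refl
  Deterministic-after {s} D (step* t₁ r₁) (step* t₂ r₂)
    with D s ([] , refl*) _ _ _ t₁ t₂
  ... | refl = Deterministic-after (Deterministic-step D t₁) r₁ r₂

  Cotrace : S → S → S → S → Set
  Cotrace i s p q = ∃[ σ ] (i =[ σ ]⇒ p × s =[ σ ]⇒ q)

  Cotrace-step : ∀ {i s p q p′ q′ a} → Cotrace i s p q →
                 p —[ a ]→ p′ → q —[ a ]→ q′ → Cotrace i s p′ q′
  Cotrace-step {a = a} (σ , ip , sq) tp tq = σ ++ [ a ] , =[]⇒-snoc ip tp , =[]⇒-snoc sq tq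

  Cotrace-isIocosRelation : ∀ {i s} → InputEnabled i → Deterministic s → i ioco s →
                            IsIocosRelation (Cotrace i s)
  Cotrace-isIocosRelation {i} {s} IE D io = record
    { ins-⊆   = λ (σ , ip , _) a _ → IE _ (σ , ip) a
    ; inp-sim = λ c a (q′ , tq) tp → q′ , tq , Cotrace-step c tp tq
    ; out-sim = out-sim
    }
    where
    out-sim : ∀ {p q} → Cotrace i s p q → ∀ (a : O) → ∀ {p′} → p —[ out a ]→ p′ →
              ∃[ q′ ] (q —[ out a ]→ q′ × Cotrace i s p′ q′)
    out-sim {p} {q} c@(σ , ip , sq) a tp
      with io σ (q , sq) a (p , ip , _ , tp)
    ... | r , sr , q′ , tr with Deterministic-after D sq sr
    ...   | refl = q′ , tr , Cotrace-step c tp tr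

proposition7 : (M : IOLTS) → let open IOLTS M in
    ∀ (i s : S) → InputEnabled i → Deterministic s → i ioco s → i iocos s
proposition7 M i s IE D io =
  Cotrace M i s , Cotrace-isIocosRelation M IE D io , ([] , IOLTS.refl* , IOLTS.refl*)
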